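{- Let $x,y$ be positive integers and let $P$ be a finite graded poset. Then $P$ avoids $(x+y)$ if and only if $P$ grade-avoids $x[b_x]+y[b_y]$ for every pair of nonnegative integers $b_x,b_y$ with $\min(b_x,b_y)=0$, $b_x<y$ and $b_y<x$.
   Context: A finite poset is graded if all maximal chains have the same number of elements; then each element has a rank, minimal elements having rank $0$ and covering relations increasing rank by $1$. $P$ contains $(a_1+\cdots+a_m)$ if there are pairwise disjoint chains $C_1,\dots,C_m$ in $P$ with $|C_i|=a_i$ such that any two elements lying in different chains are incomparable; otherwise $P$ avoids it. For positive integers $a_1,\dots,a_m$ and nonnegative integers $b_1,\dots,b_m$, a graded poset $P$ grade-contains $a_1[b_1]+\cdots+a_m[b_m]$ if there exist an integer $b$ and pairwise disjoint chains $C_1,\dots,C_m$, with any two elements in different chains incomparable, such that $C_i=\{c_{i,1}<c_{i,2}<\cdots<c_{i,a_i}\}$ and $c_{i,j}$ has rank $b_i+j+b$ for all $i,j$; otherwise $P$ grade-avoids it. -}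

module Defs where

open import Level using (Level; 0ℓ)
open import Data.Nat using (ℕ; _≤_; _<_)
import Data.Nat as ℕ
open import Data.Integer using (ℤ; +_) renaming (_+_ to _+ℤ_)
open import Data.Fin using (Fin; toℕ; fromℕ; zero; suc)
open import Data.Sum using (_⊎_)
open import Data.Product using (Σ; _×_; ∃; ∃-syntax)
open import Relation.Binary using (Rel; IsPartialOrder)
open import Relation.Binary.PropositionalEquality using (_≡_)
open import Relation.Nullary using (¬_)

record FinPoset : Set₁ where
  field
    n          : ℕ
    _≼_        : Rel (Fin n) 0ℓ
    isPartialOrder : IsPartialOrder _≡_ _≼_

module _ (P : FinPoset) where
  open FinPoset P

  _≺_ : Fin n → Fin n → Set
  x ≺ y = x ≼ y × ¬ (x ≡ y)

  Comparable : Fin n → Fin n → Set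
  Comparable x y = (x ≼ y) ⊎ (y ≼ x)

  Incomparable : Fin n → Fin n → Set
  Incomparable x y = ¬ Comparable x y

  IsChain : (k : ℕ) → (Fin k → Fin n) → Set
  IsChain k c = ∀ (i j : Fin k) → toℕ i < toℕ j → c i ≺ c j

  IsMaximalChain : (k : ℕ) → (Fin k → Fin n) → Set
  IsMaximalChain k c =
    IsChain k c × (∀ z → (∀ i → Comparable z (c i)) → ∃[ i ] (z ≡ c i))

  Graded : Set
  Graded = ∀ (k k′ : ℕ) (c : Fin k → Fin n) (c′ : Fin k′ → Fin n) →
           IsMaximalChain k c → IsMaximalChain k′ c′ → k ≡ k′

  -- x has rank r: the longest chain with top element x has r + 1 elements
  -- (in a graded poset this is the usual rank: minimal elements have rank 0,
  -- covers increase rank by 1)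
  HasRank : Fin n → ℕ → Set
  HasRank x r =
    (∃[ c ] (IsChain (ℕ.suc r) c × c (fromℕ r) ≡ x)) ×
    (∀ k (c : Fin (ℕ.suc k) → Fin n) → IsChain (ℕ.suc k) c → c (fromℕ k) ≡ x → k ≤ r)

  -- pairwise disjoint chains C i of sizes a i, elements of different chains incomparable
  -- (incomparability forces disjointness by reflexivity)
  ChainFamily : (m : ℕ) (a : Fin m → ℕ) → ((i : Fin m) → Fin (a i) → Fin n) → Set
  ChainFamily m a C =
    (∀ i → IsChain (a i) (C i)) ×
    (∀ i i′ (p : Fin (a i)) (q : Fin (a i′)) → ¬ (i ≡ i′) → Incomparable (C i p) (C i′ q))

  Contains : (m : ℕ) → (Fin m → ℕ) → Set
  Contains m a = ∃[ C ] ChainFamily m a C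

  Avoids : (m : ℕ) → (Fin m → ℕ) → Set
  Avoids m a = ¬ Contains m a

  -- P grade-contains a 1 [b 1] + ... + a m [b m]:
  -- c_{i,j} (j = 1..a i, i.e. index p with j = toℕ p + 1) has rank b i + j + b for some integer b
  GradeContains : (m : ℕ) → (Fin m → ℕ) → (Fin m → ℕ) → Set
  GradeContains m a bs =
    ∃[ b ] ∃[ C ] (ChainFamily m a C ×
      (∀ i (p : Fin (a i)) → ∃[ r ] (HasRank (C i p) r ×
          (+ r) ≡ (+ bs i) +ℤ (+ ℕ.suc (toℕ p)) +ℤ b)))

  GradeAvoids : (m : ℕ) → (Fin m → ℕ) → (Fin m → ℕ) → Set
  GradeAvoids m a bs = ¬ GradeContains m a bs

pair : ℕ → ℕ → Fin 2 → ℕ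
pair x y zero = x
pair x y (suc _) = y

{-# OPTIONS --safe #-}
module Submission where

-- Forgetting ranks turns x[b_x] + y[b_y] into (x+y). Conversely, let a₁ < … < u₁ and
-- a₂ < … < u₂ be chains of sizes x and y with no comparabilities between them; in particular
-- a₁, u₂ and a₂, u₁ are incomparable. In a graded poset each a ≼ u lies on a saturated chain
-- from a minimal element to u whose k-th element has rank k: a longest chain below u through a,
-- continued by a longest chain above u, is maximal, hence as long as any other maximal chain.
-- On such a chain for (a₁, u₁) keep the ranks in [rank a₁ ⊓ rank u₂, rank u₁], on one for
-- (a₂, u₂) the ranks in [rank a₂ ⊓ rank u₁, rank u₂]; elements kept from the two are incomparable.
-- The two rank intervals overlap and have lengths ≥ x − 1 and y − 1, so they contain overlapping
-- windows of x and y consecutive ranks, which realise x[b_x] + y[b_y] with min(b_x, b_y) = 0,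
-- b_x < y and b_y < x. Since the goal is ⊥, decidability of ≼ and the existence of longest chains
-- are used under double negation.

open import Defs hiding (_≺_)
open import Data.Nat using (ℕ; zero; suc; _+_; _∸_; _≤_; _<_; _⊓_; _⊔_; z≤n; s≤s)
open import Data.Nat.Properties
open import Data.Integer as ℤ using (+_; _⊖_)
import Data.Integer.Properties as ℤ
open import Data.Fin as Fin using (Fin; toℕ; fromℕ; zero; suc)
open import Data.Fin.Properties using (pigeonhole; toℕ≤pred[n]; toℕ-fromℕ)
open import Data.List using (List; []; _∷_; [_]; _++_; _∷ʳ_; length; lookup)
open import Data.List.Properties using (length-++)
open import Data.List.Relation.Unary.All as All using (All; []; _∷_)
import Data.List.Relation.Unary.All.Properties as All
open import Data.List.Relation.Unary.AllPairs using (AllPairs; []; _∷_)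
import Data.List.Relation.Unary.AllPairs.Properties as AllPairs
open import Data.List.Relation.Unary.Any using (here; there; index; any?)
open import Data.List.Relation.Unary.Any.Properties using (lookup-index)
open import Data.List.Membership.Propositional using (_∈_; _∉_)
open import Data.List.Membership.Propositional.Properties using (∈-lookup; ∈-++⁺ˡ; ∈-++⁺ʳ)
open import Data.List.Relation.Binary.Subset.Propositional using (_⊆_)
open import Data.List.Relation.Binary.Subset.Propositional.Properties
  using (⊆-trans; ⊆-reflexive-↭; xs⊆x∷xs; ++⁺ˡ)
open import Data.List.Relation.Binary.Permutation.Propositional as ↭ using (_↭_; prep; swap)
open import Data.List.Relation.Binary.Permutation.Propositional.Properties using (↭-length; All-resp-↭)
open import Data.Product using (Σ; _×_; _,_; proj₁; ∃; ∃₂; ∃-syntax)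
open import Data.Sum using (inj₁; inj₂)
import Data.Sum as Sum
open import Data.Empty using (⊥; ⊥-elim)
open import Function using (_∘_)
open import Level using (0ℓ)
open import Relation.Nullary using (¬_; Dec; yes; no; contradiction)
open import Relation.Nullary.Decidable using (¬¬-excluded-middle; decidable-stable)
open import Relation.Nullary.Negation using (¬¬-map)
open import Relation.Binary using (Poset; IsPartialOrder; Decidable)
import Relation.Binary.Properties.Poset as PosetProperties
open import Relation.Binary.PropositionalEquality using (_≡_; refl; sym; trans; cong; subst)

¬¬-Π-Fin : ∀ {k} {B : Fin k → Set} → (∀ i → ¬ ¬ B i) → ¬ ¬ (∀ i → B i)
¬¬-Π-Fin {zero}  _   give = give λ ()
¬¬-Π-Fin {suc k} ¬¬B give =
  ¬¬B zero λ b₀ → ¬¬-Π-Fin (λ i → ¬¬B (suc i)) λ bₛ → give λ { zero → b₀ ; (suc i) → bₛ i }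

record Maximum {A : Set} (f : A → ℕ) (Q : A → Set) : Set where
  constructor maximum
  field
    argmax    : A
    satisfies : Q argmax
    maximal   : ∀ {y} → Q y → f y ≤ f argmax

open Maximum

¬¬-maximum : {A : Set} (f : A → ℕ) {Q : A → Set} {N : ℕ} →
             (∀ {x} → Q x → f x ≤ N) → Σ A Q → ¬ ¬ Maximum f Q
¬¬-maximum f {Q} {N} bounded (x₀ , q₀) = improve N x₀ (m≤m+n N (f x₀)) q₀
  where
  improve : ∀ slack x → N ≤ slack + f x → Q x → ¬ ¬ Maximum f Q
  improve zero x N≤fx qx give = give (maximum x qx λ qy → ≤-trans (bounded qy) N≤fx)
  improve (suc slack) x N≤ qx give = ¬¬-excluded-middle {A = ∃ λ y → Q y × f x < f y} λ where
    (yes (y , qy , fx<fy)) →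
      improve slack y (≤-trans N≤ (subst (_≤ slack + f y) (+-suc slack (f x)) (+-monoʳ-≤ slack fx<fy)))
              qy give
    (no no-better) → give (maximum x qx λ qy → ≮⇒≥ λ fx<fy → no-better (_ , qy , fx<fy))

module StrictlyIncreasing (f : ℕ → ℕ) {m : ℕ} (f-< : ∀ {i} → i < m → f i < f (suc i)) where
  open ≤-Reasoning

  gap : ∀ i d → i + d ≤ m → f i + d ≤ f (i + d)
  gap i zero    _ = ≤-reflexive (trans (+-identityʳ (f i)) (cong f (sym (+-identityʳ i))))
  gap i (suc d) i+1+d≤m = begin
    f i + suc d     ≡⟨ +-suc (f i) d ⟩
    suc (f i + d)   ≤⟨ s≤s (gap i d (<⇒≤ i+d<m)) ⟩
    suc (f (i + d)) ≤⟨ f-< i+d<m ⟩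
    f (suc (i + d)) ≡⟨ cong f (sym (+-suc i d)) ⟩
    f (i + suc d)   ∎
    where
    i+d<m : i + d < m
    i+d<m = subst (_≤ m) (+-suc i d) i+1+d≤m

  bounded⇒id : f m ≤ m → ∀ {k} → k ≤ m → f k ≡ k
  bounded⇒id fm≤m {k} k≤m = ≤-antisym upper lower
    where
    k+[m∸k]≡m : k + (m ∸ k) ≡ m
    k+[m∸k]≡m = m+[n∸m]≡n k≤m
    lower : k ≤ f k
    lower = ≤-trans (m≤n+m k (f 0)) (gap 0 k k≤m)
    upper : f k ≤ k
    upper = +-cancelʳ-≤ (m ∸ k) (f k) k (begin
      f k + (m ∸ k)   ≤⟨ gap k (m ∸ k) (≤-reflexive k+[m∸k]≡m) ⟩
      f (k + (m ∸ k)) ≡⟨ cong f k+[m∸k]≡m ⟩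
      f m             ≤⟨ fm≤m ⟩
      m               ≡⟨ sym k+[m∸k]≡m ⟩
      k + (m ∸ k)     ∎)

-- The lowest start ≥ l of a window of width w that still reaches l′.
window : ℕ → ℕ → ℕ → ℕ
window l l′ w = l ⊔ (l′ ∸ w)

window-fits : ∀ l l′ w {h} → l + w ≤ h → l′ ≤ h → window l l′ w + w ≤ h
window-fits l l′ w {h} l+w≤h l′≤h =
  subst (_≤ h) (sym (+-distribʳ-⊔ w l (l′ ∸ w))) (⊔-lub l+w≤h l′∸w+w≤h)
  where
  l′∸w+w≤h : l′ ∸ w + w ≤ h
  l′∸w+w≤h with ≤-total w l′
  ... | inj₁ w≤l′ = subst (_≤ h) (sym (m∸n+n≡m w≤l′)) l′≤h
  ... | inj₂ l′≤w = subst (λ d → d + w ≤ h) (sym (m≤n⇒m∸n≡0 l′≤w)) (≤-trans (m≤n+m w l) l+w≤h)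

window-overlap : ∀ l l′ w w′ → window l l′ w ≤ window l′ l w′ + w′
window-overlap l l′ w w′ = ⊔-lub l≤ l′∸w≤
  where
  l≤ : l ≤ window l′ l w′ + w′
  l≤ = ≤-trans (≤-trans (m≤n+m∸n l w′) (≤-reflexive (+-comm w′ (l ∸ w′))))
               (+-monoˡ-≤ w′ (m≤n⊔m l′ (l ∸ w′)))
  l′∸w≤ : l′ ∸ w ≤ window l′ l w′ + w′
  l′∸w≤ = ≤-trans (m∸n≤m l′ w) (≤-trans (m≤m⊔n l′ (l ∸ w′)) (m≤m+n _ w′))

overlapping-windows : ∀ {l₁ h₁ x l₂ h₂ y} → l₁ + x ≤ h₁ → l₂ + y ≤ h₂ → l₂ ≤ h₁ → l₁ ≤ h₂ →
  ∃₂ λ s t → l₁ ≤ s × s + x ≤ h₁ × l₂ ≤ t × t + y ≤ h₂ × s ≤ t + y × t ≤ s + x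
overlapping-windows {l₁} {_} {x} {l₂} {_} {y} fits₁ fits₂ l₂≤h₁ l₁≤h₂ =
  window l₁ l₂ x , window l₂ l₁ y ,
  m≤m⊔n l₁ (l₂ ∸ x) , window-fits l₁ l₂ x fits₁ l₂≤h₁ , m≤m⊔n l₂ (l₁ ∸ y) , window-fits l₂ l₁ y fits₂ l₁≤h₂ ,
  window-overlap l₁ l₂ x y , window-overlap l₂ l₁ y x

m⊓n≤o<m⇒n≤o : ∀ {m n o} → m ⊓ n ≤ o → o < m → n ≤ o
m⊓n≤o<m⇒n≤o {m} {n} m⊓n≤o o<m with ≤-total m n
... | inj₁ m≤n = contradiction (subst (_≤ _) (m≤n⇒m⊓n≡m m≤n) m⊓n≤o) (<⇒≱ o<m)
... | inj₂ n≤m = subst (_≤ _) (m≥n⇒m⊓n≡n n≤m) m⊓n≤o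

+[s+k]≡+d+[1+k]+[m⊖1] : ∀ m d {s} → m + d ≡ s → ∀ k → + (s + k) ≡ + d ℤ.+ + suc k ℤ.+ (m ⊖ 1)
+[s+k]≡+d+[1+k]+[m⊖1] m d refl k = begin
  + (m + d + k)           ≡⟨ cong +_ (trans (+-assoc m d k) (+-comm m (d + k))) ⟩
  suc (d + k + m) ⊖ 1     ≡⟨ cong (λ n → n + m ⊖ 1) (sym (+-suc d k)) ⟩
  d + suc k + m ⊖ 1       ≡⟨ ℤ.distribʳ-⊖-+-pos (d + suc k) m 1 ⟨
  + d ℤ.+ + suc k ℤ.+ (m ⊖ 1) ∎
  where open Relation.Binary.PropositionalEquality.≡-Reasoning

nth : {A : Set} → A → List A → ℕ → A
nth d []       _       = d
nth d (x ∷ _)  zero    = x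
nth d (_ ∷ xs) (suc i) = nth d xs i

nth-All : ∀ {A : Set} {P : A → Set} {d xs i} → All P xs → i < length xs → P (nth d xs i)
nth-All {i = zero}  (px ∷ _)   _         = px
nth-All {i = suc i} (_ ∷ pxs) (s≤s i<n) = nth-All pxs i<n

nth-pairwise : ∀ {A : Set} {R : A → A → Set} {d xs i j} →
               AllPairs R xs → i < j → j < length xs → R (nth d xs i) (nth d xs j)
nth-pairwise {i = zero}  {suc j} (Rx ∷ _)   _         (s≤s j<n) = nth-All Rx j<n
nth-pairwise {i = suc i} {suc j} (_ ∷ Rxs) (s≤s i<j) (s≤s j<n) = nth-pairwise Rxs i<j j<n

∈⇒nth : ∀ {A : Set} {d x : A} {xs} → x ∈ xs → ∃[ i ] (i < length xs × nth d xs i ≡ x)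
∈⇒nth (here refl) = zero , s≤s z≤n , refl
∈⇒nth (there x∈xs) with ∈⇒nth x∈xs
... | i , i<n , nth≡x = suc i , s≤s i<n , nth≡x

nth-∷ʳ : ∀ {A : Set} (d : A) xs x → nth d (xs ∷ʳ x) (length xs) ≡ x
nth-∷ʳ d []       x = refl
nth-∷ʳ d (_ ∷ xs) x = nth-∷ʳ d xs x

AllPairs-lookup : ∀ {A : Set} {R : A → A → Set} {xs} →
                  AllPairs R xs → ∀ {i j} → i Fin.< j → R (lookup xs i) (lookup xs j)
AllPairs-lookup {xs = _ ∷ xs} (Rx ∷ _)  {zero}  {suc j} _         = All.lookup Rx (∈-lookup {xs = xs} j)
AllPairs-lookup               (_ ∷ Rxs) {suc i} {suc j} (s≤s i<j) = AllPairs-lookup Rxs i<j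

GradeContains⇒Contains : ∀ P {m a bs} → GradeContains P m a bs → Contains P m a
GradeContains⇒Contains _ (_ , C , family , _) = C , family

module Chains (P : FinPoset) where
  open FinPoset P
  open IsPartialOrder isPartialOrder using () renaming (refl to ≼-refl; trans to ≼-trans)

  E : Set
  E = Fin n

  poset : Poset 0ℓ 0ℓ 0ℓ
  poset = record { isPartialOrder = isPartialOrder }

  open PosetProperties poset using () renaming (_<_ to _≺_; <-trans to ≺-trans; <-irrefl to ≺-irrefl)

  Incomparable-sym : ∀ {x y} → Incomparable P x y → Incomparable P y x
  Incomparable-sym x#y = x#y ∘ Sum.swap

  IsChain-first≼last : ∀ {k c} → IsChain P (suc k) c → c zero ≼ c (fromℕ k)
  IsChain-first≼last {zero}  _     = ≼-refl
  IsChain-first≼last {suc k} chain = proj₁ (chain zero (fromℕ (suc k)) (s≤s z≤n))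

  pairᶜ : ∀ {x y} → (Fin x → E) → (Fin y → E) → (i : Fin 2) → Fin (pair x y i) → E
  pairᶜ S T zero       = S
  pairᶜ S T (suc zero) = T

  pair-ChainFamily : ∀ {x y S T} → IsChain P x S → IsChain P y T → (∀ p q → Incomparable P (S p) (T q)) →
                     ChainFamily P 2 (pair x y) (pairᶜ S T)
  pair-ChainFamily {x} {y} {S} {T} S-chain T-chain S#T = chains , cross
    where
    chains : ∀ i → IsChain P (pair x y i) (pairᶜ S T i)
    chains zero       = S-chain
    chains (suc zero) = T-chain
    cross : ∀ i i′ p q → ¬ i ≡ i′ → Incomparable P (pairᶜ S T i p) (pairᶜ S T i′ q)
    cross zero       zero       _ _ i≢i = contradiction refl i≢i
    cross zero       (suc zero) p q _   = S#T p q
    cross (suc zero) zero       p q _   = Incomparable-sym (S#T q p)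
    cross (suc zero) (suc zero) _ _ i≢i = contradiction refl i≢i

  -- The shift b = s ⊓ t − 1 gives (s ∸ t) + (p + 1) + b = s + p.
  consecutive-ranks⇒GradeContains :
    ∀ {x y S T s t} → IsChain P x S → IsChain P y T → (∀ p q → Incomparable P (S p) (T q)) →
    (∀ p → HasRank P (S p) (s + toℕ p)) → (∀ q → HasRank P (T q) (t + toℕ q)) →
    GradeContains P 2 (pair x y) (pair (s ∸ t) (t ∸ s))
  consecutive-ranks⇒GradeContains {S = S} {T} {s} {t} S-chain T-chain S#T S-rank T-rank =
    s ⊓ t ⊖ 1 , pairᶜ S T , pair-ChainFamily S-chain T-chain S#T , ranks
    where
    ranks : ∀ i p → ∃[ r ] (HasRank P (pairᶜ S T i p) r ×
                            + r ≡ + pair (s ∸ t) (t ∸ s) i ℤ.+ + suc (toℕ p) ℤ.+ (s ⊓ t ⊖ 1))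
    ranks zero       p = s + toℕ p , S-rank p ,
      +[s+k]≡+d+[1+k]+[m⊖1] (s ⊓ t) (s ∸ t) (trans (cong (_+ (s ∸ t)) (⊓-comm s t)) (m⊓n+n∸m≡n t s)) (toℕ p)
    ranks (suc zero) q = t + toℕ q , T-rank q , +[s+k]≡+d+[1+k]+[m⊖1] (s ⊓ t) (t ∸ s) (m⊓n+n∸m≡n s t) (toℕ q)

  Chain : List E → Set
  Chain = AllPairs _≺_

  ChainIn : (E → Set) → List E → Set
  ChainIn S Y = Chain Y × All S Y

  Below Above : E → List E → Set
  Below u = ChainIn (_≺ u)
  Above u = ChainIn (u ≺_)

  Longest : (List E → Set) → Set
  Longest = Maximum length

  Saturated : (List E → Set) → List E → Set
  Saturated C Y = C Y × (∀ {Y′} → C Y′ → Y ⊆ Y′ → length Y′ ≤ length Y)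

  longest⇒saturated : ∀ {C} (L : Longest C) → Saturated C (argmax L)
  longest⇒saturated L = satisfies L , λ C-Y′ _ → maximal L C-Y′

  lookup-IsChain : ∀ {Y} → Chain Y → IsChain P (length Y) (lookup Y)
  lookup-IsChain chain _ _ = AllPairs-lookup chain

  chain-length≤ : ∀ {Y} → Chain Y → length Y ≤ n
  chain-length≤ {Y} chain = ≮⇒≥ λ n<|Y| →
    let i , j , i<j , Yi≡Yj = pigeonhole n<|Y| (lookup Y) in ≺-irrefl Yi≡Yj (AllPairs-lookup chain i<j)

  chain-through : ∀ {u Y Z} → Below u Y → Above u Z → Chain (Y ++ u ∷ Z)
  chain-through (Y-chain , Y≺u) (Z-chain , u≺Z) =
    AllPairs.++⁺ Y-chain (u≺Z ∷ Z-chain) (All.map (λ y≺u → y≺u ∷ All.map (≺-trans y≺u) u≺Z) Y≺u)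

  Below-∷ʳ : ∀ {x y Y} → Below x Y → x ≺ y → Below y (Y ∷ʳ x)
  Below-∷ʳ below@(_ , Y≺x) x≺y =
    chain-through below ([] , []) , All.++⁺ (All.map (λ z≺x → ≺-trans z≺x x≺y) Y≺x) (x≺y ∷ [])

  module _ (_≼?_ : Decidable _≼_) where

    insert : ∀ {z Y} → Chain Y → All (Comparable P z) Y → z ∉ Y → ∃[ Y′ ] (Chain Y′ × z ∷ Y ↭ Y′)
    insert {z} {[]}    [] [] _ = [ z ] , [] ∷ [] , ↭.refl
    insert {z} {y ∷ Y} (y≺Y ∷ chain) (z~y ∷ z~Y) z∉y∷Y with y ≼? z
    ... | yes y≼z =
      let Y′ , chain′ , z∷Y↭Y′ = insert chain z~Y (z∉y∷Y ∘ there)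
          y≺z = y≼z , λ y≡z → z∉y∷Y (here (sym y≡z))
      in y ∷ Y′ , All-resp-↭ z∷Y↭Y′ (y≺z ∷ y≺Y) ∷ chain′ , ↭.trans (swap z y ↭.refl) (prep y z∷Y↭Y′)
    ... | no y⋠z = z ∷ y ∷ Y , (z≺y ∷ All.map (≺-trans z≺y) y≺Y) ∷ y≺Y ∷ chain , ↭.refl
      where
      z≺y : z ≺ y
      z≺y = Sum.[ (λ z≼y → z≼y , z∉y∷Y ∘ here) , (λ y≼z → contradiction y≼z y⋠z) ] z~y

    saturated-closed : ∀ {S Y z} → Saturated (ChainIn S) Y → S z → All (Comparable P z) Y → z ∉ Y → ⊥
    saturated-closed ((chain , S-Y) , saturated) S-z z~Y z∉Y =
      let Y′ , chain′ , z∷Y↭Y′ = insert chain z~Y z∉Y in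
      1+n≰n (subst (_≤ _) (sym (↭-length z∷Y↭Y′))
        (saturated (chain′ , All-resp-↭ z∷Y↭Y′ (S-z ∷ S-Y)) (⊆-trans (xs⊆x∷xs _ _) (⊆-reflexive-↭ z∷Y↭Y′))))

    saturated-maximal : ∀ {u Y Z} → Saturated (Below u) Y → Saturated (Above u) Z →
                        IsMaximalChain P (length (Y ++ u ∷ Z)) (lookup (Y ++ u ∷ Z))
    saturated-maximal {u} {Y} {Z} saturated-Y saturated-Z =
      lookup-IsChain (chain-through (proj₁ saturated-Y) (proj₁ saturated-Z)) , nothing-to-add
      where
      M : List E
      M = Y ++ u ∷ Z
      nothing-to-add : ∀ z → (∀ i → Comparable P z (lookup M i)) → ∃[ i ] (z ≡ lookup M i)
      nothing-to-add z z~M with any? (z Fin.≟_) M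
      ... | yes z∈M = index z∈M , lookup-index z∈M
      ... | no z∉M  = ⊥-elim (extend (All.head z~u∷Z))
        where
        z~all : All (Comparable P z) M
        z~all = All.tabulate λ w∈M → subst (Comparable P z) (sym (lookup-index w∈M)) (z~M (index w∈M))
        z~u∷Z : All (Comparable P z) (u ∷ Z)
        z~u∷Z = All.++⁻ʳ Y z~all
        z≢u : ¬ z ≡ u
        z≢u z≡u = z∉M (∈-++⁺ʳ Y (here z≡u))
        extend : Comparable P z u → ⊥
        extend (inj₁ z≼u) = saturated-closed saturated-Y (z≼u , z≢u) (All.++⁻ˡ Y z~all) (z∉M ∘ ∈-++⁺ˡ)
        extend (inj₂ u≼z) =
          saturated-closed saturated-Z (u≼z , z≢u ∘ sym) (All.tail z~u∷Z) (z∉M ∘ ∈-++⁺ʳ Y ∘ there)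

    module Ranked (longest-below : ∀ x → Longest (Below x)) (graded : Graded P) where

      rank : E → ℕ
      rank x = length (argmax (longest-below x))

      rank-≺ : ∀ {x y} → x ≺ y → rank x < rank y
      rank-≺ {x} {y} x≺y = subst (_≤ rank y) (trans (length-++ Y) (+-comm (length Y) 1))
                                 (maximal (longest-below y) (Below-∷ʳ (satisfies (longest-below x)) x≺y))
        where
        Y : List E
        Y = argmax (longest-below x)

      rank-≼ : ∀ {x y} → x ≼ y → rank x ≤ rank y
      rank-≼ {x} {y} x≼y with x Fin.≟ y
      ... | yes refl = ≤-refl
      ... | no x≢y   = <⇒≤ (rank-≺ (x≼y , x≢y))

      ≼∧rank≤⇒≡ : ∀ {x y} → x ≼ y → rank y ≤ rank x → x ≡ y
      ≼∧rank≤⇒≡ {x} {y} x≼y ry≤rx with x Fin.≟ y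
      ... | yes x≡y = x≡y
      ... | no x≢y  = contradiction (rank-≺ (x≼y , x≢y)) (≤⇒≯ ry≤rx)

      IsChain⇒rank-gap : ∀ k {c : Fin (suc k) → E} → IsChain P (suc k) c →
                         rank (c zero) + k ≤ rank (c (fromℕ k))
      IsChain⇒rank-gap zero    _     = ≤-reflexive (+-identityʳ _)
      IsChain⇒rank-gap (suc k) {c} chain = begin
        rank (c zero) + suc k     ≡⟨ +-suc (rank (c zero)) k ⟩
        suc (rank (c zero)) + k   ≤⟨ +-monoˡ-≤ k (rank-≺ (chain zero (suc zero) (s≤s z≤n))) ⟩
        rank (c (suc zero)) + k   ≤⟨ IsChain⇒rank-gap k (λ i j i<j → chain (suc i) (suc j) (s≤s i<j)) ⟩
        rank (c (fromℕ (suc k))) ∎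
        where open ≤-Reasoning

      -- With Z a longest chain above u, both Y ++ u ∷ Z and (a longest chain below u) ++ u ∷ Z
      -- are maximal, so gradedness equates their lengths.
      saturated-length : ∀ {u Y} → Saturated (Below u) Y → length Y ≡ rank u
      saturated-length {u} {Y} saturated-Y = decidable-stable (length Y ≟ rank u) λ |Y|≢rank →
        ¬¬-maximum length (chain-length≤ ∘ proj₁) ([] , [] , []) λ longest-above →
        let Z = argmax longest-above
            saturated-Z = longest⇒saturated longest-above
            Y₀ = argmax (longest-below u)
            same-length = graded _ _ _ _ (saturated-maximal saturated-Y saturated-Z)
                                         (saturated-maximal (longest⇒saturated (longest-below u)) saturated-Z)
        in |Y|≢rank (+-cancelʳ-≡ (length (u ∷ Z)) (length Y) (length Y₀)
                       (trans (sym (length-++ Y)) (trans same-length (length-++ Y₀))))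

      -- A saturated chain from a minimal element through a up to u, indexed by rank;
      -- rungs above rank u are junk.
      record Ladder (a u : E) : Set where
        field
          rung      : ℕ → E
          rung-≺    : ∀ {i j} → i < j → j ≤ rank u → rung i ≺ rung j
          rank-rung : ∀ {k} → k ≤ rank u → rank (rung k) ≡ k
          rung-a    : rung (rank a) ≡ a
          rung-u    : rung (rank u) ≡ u

        rung-≼ : ∀ {i j} → i ≤ j → j ≤ rank u → rung i ≼ rung j
        rung-≼ i≤j j≤ru with m≤n⇒m<n∨m≡n i≤j
        ... | inj₁ i<j  = proj₁ (rung-≺ i<j j≤ru)
        ... | inj₂ refl = ≼-refl

        a≼rung : ∀ {i} → rank a ≤ i → i ≤ rank u → a ≼ rung i
        a≼rung a≤i i≤u = subst (_≼ rung _) rung-a (rung-≼ a≤i i≤u)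

        rung≼u : ∀ {i} → i ≤ rank u → rung i ≼ u
        rung≼u i≤u = subst (rung _ ≼_) rung-u (rung-≼ i≤u ≤-refl)

        rung≼a : ∀ {i} → i ≤ rank a → rank a ≤ rank u → rung i ≼ a
        rung≼a i≤a a≤u = subst (rung _ ≼_) rung-a (rung-≼ i≤a a≤u)

        rung-HasRank : ∀ {k} → k ≤ rank u → HasRank P (rung k) k
        rung-HasRank {k} k≤ru = (prefix , prefix-chain , cong rung (toℕ-fromℕ k)) , below-bound
          where
          prefix : Fin (suc k) → E
          prefix i = rung (toℕ i)
          prefix-chain : IsChain P (suc k) prefix
          prefix-chain i j i<j = rung-≺ i<j (≤-trans (toℕ≤pred[n] j) k≤ru)
          below-bound : ∀ k′ c → IsChain P (suc k′) c → c (fromℕ k′) ≡ rung k → k′ ≤ k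
          below-bound k′ c chain top≡rung = begin
            k′                     ≤⟨ m≤n+m k′ (rank (c zero)) ⟩
            rank (c zero) + k′     ≤⟨ IsChain⇒rank-gap k′ chain ⟩
            rank (c (fromℕ k′))    ≡⟨ cong rank top≡rung ⟩
            rank (rung k)          ≡⟨ rank-rung k≤ru ⟩
            k                      ∎
            where open ≤-Reasoning

      open Ladder

      chain⇒Ladder : ∀ {a u F} → Chain F → length F ≡ suc (rank u) → nth u F (rank u) ≡ u → a ∈ F → Ladder a u
      chain⇒Ladder {a} {u} {F} chain |F|≡ top a∈F = record
        { rung = nth u F ; rung-≺ = F-≺ ; rank-rung = rank-F ; rung-a = F-a ; rung-u = top }
        where
        F-≺ : ∀ {i j} → i < j → j ≤ rank u → nth u F i ≺ nth u F j
        F-≺ i<j j≤ru = nth-pairwise chain i<j (subst (_ <_) (sym |F|≡) (s≤s j≤ru))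
        rank-F : ∀ {k} → k ≤ rank u → rank (nth u F k) ≡ k
        rank-F = StrictlyIncreasing.bounded⇒id (rank ∘ nth u F) (λ i<ru → rank-≺ (F-≺ (n<1+n _) i<ru))
                                               (≤-reflexive (cong rank top))
        F-a : nth u F (rank a) ≡ a
        F-a with ∈⇒nth a∈F
        ... | i , i<|F| , Fi≡a =
          subst (λ k → nth u F k ≡ a) (trans (sym (rank-F i≤ru)) (cong rank Fi≡a)) Fi≡a
          where
          i≤ru : i ≤ rank u
          i≤ru = ≤-pred (subst (i <_) |F|≡ i<|F|)

      -- Take a longest chain below u among those which, followed by u, pass through a.
      ladder : ∀ {a u} → a ≼ u → ¬ ¬ Ladder a u
      ladder {a} {u} a≼u = ¬¬-map from-longest (¬¬-maximum length (chain-length≤ ∘ proj₁ ∘ proj₁) start)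
        where
        Through : List E → Set
        Through Y = Below u Y × a ∈ Y ∷ʳ u
        start : ∃ Through
        start with a Fin.≟ u
        ... | yes a≡u = [] , ([] , []) , here a≡u
        ... | no a≢u  = [ a ] , ([] ∷ [] , (a≼u , a≢u) ∷ []) , here refl
        from-longest : Longest Through → Ladder a u
        from-longest (maximum Y (below-Y , a∈Y∷ʳu) longest) =
          chain⇒Ladder (chain-through below-Y ([] , [])) |Y∷ʳu|≡ top a∈Y∷ʳu
          where
          saturated-Y : Saturated (Below u) Y
          saturated-Y = below-Y , λ below-Y′ Y⊆Y′ → longest (below-Y′ , ++⁺ˡ [ u ] Y⊆Y′ a∈Y∷ʳu)
          |Y|≡rank : length Y ≡ rank u
          |Y|≡rank = saturated-length saturated-Y
          |Y∷ʳu|≡ : length (Y ∷ʳ u) ≡ suc (rank u)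
          |Y∷ʳu|≡ = trans (length-++ Y) (trans (+-comm (length Y) 1) (cong suc |Y|≡rank))
          top : nth u (Y ∷ʳ u) (rank u) ≡ u
          top = subst (λ k → nth u (Y ∷ʳ u) k ≡ u) |Y|≡rank (nth-∷ʳ u Y u)

      -- Below rank a₂, the rung w of L₂ lies under a₂ but has rank ≥ rank u₁; so w ≼ z ≼ u₁ forces w = u₁.
      rungs-incomparable : ∀ {a₁ u₁ a₂ u₂ i j} → a₂ ≼ u₂ → Incomparable P a₁ u₂ → Incomparable P a₂ u₁ →
        (L₁ : Ladder a₁ u₁) (L₂ : Ladder a₂ u₂) →
        rank a₁ ≤ i → i ≤ rank u₁ → rank a₂ ⊓ rank u₁ ≤ j → j ≤ rank u₂ →
        Incomparable P (rung L₁ i) (rung L₂ j)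
      rungs-incomparable {a₁} {u₁} {a₂} {_} {i} {j} a₂≼u₂ a₁#u₂ a₂#u₁ L₁ L₂ a₁≤i i≤u₁ lo≤j j≤u₂ =
        cases (rank a₂ ≤? j)
        where
        z w : E
        z = rung L₁ i
        w = rung L₂ j
        a₁≼z : a₁ ≼ z
        a₁≼z = a≼rung L₁ a₁≤i i≤u₁
        z≼u₁ : z ≼ u₁
        z≼u₁ = rung≼u L₁ i≤u₁
        cases : Dec (rank a₂ ≤ j) → Incomparable P z w
        cases (yes a₂≤j) (inj₁ z≼w) = a₁#u₂ (inj₁ (≼-trans a₁≼z (≼-trans z≼w (rung≼u L₂ j≤u₂))))
        cases (yes a₂≤j) (inj₂ w≼z) = a₂#u₁ (inj₁ (≼-trans (a≼rung L₂ a₂≤j j≤u₂) (≼-trans w≼z z≼u₁)))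
        cases (no a₂≰j)  z~w        = case-below z~w
          where
          w≼a₂ : w ≼ a₂
          w≼a₂ = rung≼a L₂ (<⇒≤ (≰⇒> a₂≰j)) (rank-≼ a₂≼u₂)
          u₁≤w : rank u₁ ≤ rank w
          u₁≤w = subst (rank u₁ ≤_) (sym (rank-rung L₂ j≤u₂)) (m⊓n≤o<m⇒n≤o lo≤j (≰⇒> a₂≰j))
          case-below : Comparable P z w → ⊥
          case-below (inj₁ z≼w) = a₁#u₂ (inj₁ (≼-trans a₁≼z (≼-trans z≼w (≼-trans w≼a₂ a₂≼u₂))))
          case-below (inj₂ w≼z) = a₂#u₁ (inj₂ (subst (_≼ a₂) (≼∧rank≤⇒≡ (≼-trans w≼z z≼u₁) u₁≤w) w≼a₂))

      ladders-incomparable : ∀ {a₁ u₁ a₂ u₂ i j} → a₁ ≼ u₁ → a₂ ≼ u₂ →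
        Incomparable P a₁ u₂ → Incomparable P a₂ u₁ →
        (L₁ : Ladder a₁ u₁) (L₂ : Ladder a₂ u₂) →
        rank a₁ ⊓ rank u₂ ≤ i → i ≤ rank u₁ → rank a₂ ⊓ rank u₁ ≤ j → j ≤ rank u₂ →
        Incomparable P (rung L₁ i) (rung L₂ j)
      ladders-incomparable {a₁} {u₁} {a₂} {u₂} {i} {j} a₁≼u₁ a₂≼u₂ a₁#u₂ a₂#u₁ L₁ L₂ lo₁≤i i≤u₁ lo₂≤j j≤u₂
        with rank a₁ ≤? i | rank a₂ ≤? j
      ... | yes a₁≤i | _        = rungs-incomparable a₂≼u₂ a₁#u₂ a₂#u₁ L₁ L₂ a₁≤i i≤u₁ lo₂≤j j≤u₂
      ... | no _     | yes a₂≤j =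
        Incomparable-sym (rungs-incomparable a₁≼u₁ a₂#u₁ a₁#u₂ L₂ L₁ a₂≤j j≤u₂ lo₁≤i i≤u₁)
      ... | no a₁≰i  | no a₂≰j  = contradiction refl (<⇒≢ (begin-strict
        i       <⟨ ≰⇒> a₁≰i ⟩
        rank a₁ ≤⟨ rank-≼ a₁≼u₁ ⟩
        rank u₁ ≤⟨ m⊓n≤o<m⇒n≤o lo₂≤j (≰⇒> a₂≰j) ⟩
        j       ≤⟨ j≤u₂ ⟩
        rank u₂ ≤⟨ m⊓n≤o<m⇒n≤o lo₁≤i (≰⇒> a₁≰i) ⟩
        i       ∎))
        where open ≤-Reasoning

      ladders⇒GradeContains : ∀ {a₁ u₁ a₂ u₂ x′ y′} → a₁ ≼ u₁ → a₂ ≼ u₂ →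
        Incomparable P a₁ u₂ → Incomparable P a₂ u₁ → Ladder a₁ u₁ → Ladder a₂ u₂ →
        rank a₁ + x′ ≤ rank u₁ → rank a₂ + y′ ≤ rank u₂ →
        ∃₂ λ s t → s ≤ t + y′ × t ≤ s + x′ × GradeContains P 2 (pair (suc x′) (suc y′)) (pair (s ∸ t) (t ∸ s))
      ladders⇒GradeContains {a₁} {u₁} {a₂} {u₂} {x′} {y′} a₁≼u₁ a₂≼u₂ a₁#u₂ a₂#u₁ L₁ L₂ long₁ long₂
        with overlapping-windows (≤-trans (+-monoˡ-≤ x′ (m⊓n≤m (rank a₁) (rank u₂))) long₁)
                                 (≤-trans (+-monoˡ-≤ y′ (m⊓n≤m (rank a₂) (rank u₁))) long₂)
                                 (m⊓n≤n (rank a₂) (rank u₁)) (m⊓n≤n (rank a₁) (rank u₂))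
      ... | s , t , lo₁≤s , s+x′≤u₁ , lo₂≤t , t+y′≤u₂ , s≤t+y′ , t≤s+x′ =
        s , t , s≤t+y′ , t≤s+x′ ,
        consecutive-ranks⇒GradeContains S-chain T-chain S#T
          (λ p → rung-HasRank L₁ (in₁ p)) (λ q → rung-HasRank L₂ (in₂ q))
        where
        S : Fin (suc x′) → E
        S p = rung L₁ (s + toℕ p)
        T : Fin (suc y′) → E
        T q = rung L₂ (t + toℕ q)
        in₁ : ∀ p → s + toℕ p ≤ rank u₁
        in₁ p = ≤-trans (+-monoʳ-≤ s (toℕ≤pred[n] p)) s+x′≤u₁
        in₂ : ∀ q → t + toℕ q ≤ rank u₂
        in₂ q = ≤-trans (+-monoʳ-≤ t (toℕ≤pred[n] q)) t+y′≤u₂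
        S-chain : IsChain P (suc x′) S
        S-chain _ j i<j = rung-≺ L₁ (+-monoʳ-< s i<j) (in₁ j)
        T-chain : IsChain P (suc y′) T
        T-chain _ j i<j = rung-≺ L₂ (+-monoʳ-< t i<j) (in₂ j)
        S#T : ∀ p q → Incomparable P (S p) (T q)
        S#T p q = ladders-incomparable a₁≼u₁ a₂≼u₂ a₁#u₂ a₂#u₁ L₁ L₂
                    (≤-trans lo₁≤s (m≤m+n s (toℕ p))) (in₁ p) (≤-trans lo₂≤t (m≤m+n t (toℕ q))) (in₂ q)

  Contains⇒GradeContains : ∀ {x′ y′} → Graded P → Contains P 2 (pair (suc x′) (suc y′)) →
    ¬ ¬ (∃₂ λ bx by → bx ⊓ by ≡ 0 × bx < suc y′ × by < suc x′ ×
                      GradeContains P 2 (pair (suc x′) (suc y′)) (pair bx by))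
  Contains⇒GradeContains {x′} {y′} graded (C , chains , cross) give =
    ¬¬-Π-Fin (λ _ → ¬¬-Π-Fin λ _ → ¬¬-excluded-middle) λ _≼?_ →
    ¬¬-Π-Fin (λ _ → ¬¬-maximum length (chain-length≤ ∘ proj₁) ([] , [] , [])) λ longest-below →
    let open Ranked _≼?_ longest-below graded in
    ladder a₁≼u₁ λ L₁ → ladder a₂≼u₂ λ L₂ →
    let s , t , s≤t+y′ , t≤s+x′ , contains =
          ladders⇒GradeContains a₁≼u₁ a₂≼u₂ a₁#u₂ a₂#u₁ L₁ L₂
                                (IsChain⇒rank-gap x′ (chains zero)) (IsChain⇒rank-gap y′ (chains (suc zero)))
    in give (s ∸ t , t ∸ s , [m∸n]⊓[n∸m]≡0 s t ,
             s≤s (m≤n+o⇒m∸n≤o s t s≤t+y′) , s≤s (m≤n+o⇒m∸n≤o t s t≤s+x′) , contains)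
    where
    a₁ u₁ a₂ u₂ : E
    a₁ = C zero zero
    u₁ = C zero (fromℕ x′)
    a₂ = C (suc zero) zero
    u₂ = C (suc zero) (fromℕ y′)
    a₁≼u₁ : a₁ ≼ u₁
    a₁≼u₁ = IsChain-first≼last (chains zero)
    a₂≼u₂ : a₂ ≼ u₂
    a₂≼u₂ = IsChain-first≼last (chains (suc zero))
    a₁#u₂ : Incomparable P a₁ u₂
    a₁#u₂ = cross zero (suc zero) zero (fromℕ y′) λ ()
    a₂#u₁ : Incomparable P a₂ u₁
    a₂#u₁ = Incomparable-sym (cross zero (suc zero) (fromℕ x′) zero λ ())

lemma5p1 : (x y : ℕ) → 0 < x → 0 < y → (P : FinPoset) → Graded P →
    (Avoids P 2 (pair x y) →
       ∀ (bx by : ℕ) → bx ⊓ by ≡ 0 → bx < y → by < x → GradeAvoids P 2 (pair x y) (pair bx by))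
    × ((∀ (bx by : ℕ) → bx ⊓ by ≡ 0 → bx < y → by < x → GradeAvoids P 2 (pair x y) (pair bx by))
       → Avoids P 2 (pair x y))
lemma5p1 (suc x′) (suc y′) _ _ P graded =
  (λ avoids _ _ _ _ _ → avoids ∘ GradeContains⇒Contains P) ,
  λ grade-avoids contains → Chains.Contains⇒GradeContains P graded contains
    λ (bx , by , bx⊓by≡0 , bx<y , by<x , grade-contains) → grade-avoids bx by bx⊓by≡0 bx<y by<x grade-contains
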